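{- Let $k\ge 1$ and $n$ be positive integers with $n>\binom{2k-1}{k}$. Let $f(n,k)$ denote the smallest possible number of sets in a $k$-hyperseparating set system on an $n$-element underlying set. Then $$\min\Big\{m:2^{k}\binom{m}{k}\ge n\Big\}\le f(n,k)\le \min\Big\{m:\binom{m}{k}\ge n\Big\}.$$
   Context: A set system on an underlying set $V$ is a family $\mathcal{F}$ of subsets of $V$. The set system $\mathcal{F}\subseteq 2^V$ is called $k$-hyperseparating if for every element $v\in V$ there exist sets $A_1,\dots,A_k\in\mathcal{F}$ and an index $i\in\{0,1,\dots,k\}$ such that $v\in A_1,\dots,A_i$ and $v\notin A_{i+1},\dots,A_k$, and no other element $u\in V$, $u\neq v$, satisfies this same property (i.e., there is no $u\neq v$ with $u\in A_1,\dots,A_i$ and $u\notin A_{i+1},\dots,A_k$). -}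

module Defs where

open import Data.Nat using (ℕ; suc; _≤_; _<_)
open import Data.Fin using (Fin; toℕ)
open import Data.Fin.Subset using (Subset; _∈_; _∉_)
open import Data.Product using (Σ; _×_)
open import Relation.Binary.PropositionalEquality using (_≡_)
open import Function.Definitions using (Injective)

-- A set system with m (distinct) sets on the underlying set Fin n:
-- an injective indexing F : Fin m → Subset n.
SetSystem : ℕ → ℕ → Set
SetSystem n m = Σ (Fin m → Subset n) (λ F → Injective _≡_ _≡_ F)

-- u ∈ A₁,…,Aᵢ and u ∉ A_{i+1},…,A_k, where A_{j+1} = F (σ j) (0-based j).
Pattern : {n m k : ℕ} → (Fin m → Subset n) → (Fin k → Fin m) → Fin (suc k) → Fin n → Set
Pattern {k = k} F σ i u =
  (j : Fin k) → (toℕ j < toℕ i → u ∈ F (σ j)) × (toℕ i ≤ toℕ j → u ∉ F (σ j))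

IsHyperseparating : (n m k : ℕ) → (Fin m → Subset n) → Set
IsHyperseparating n m k F =
  (v : Fin n) → Σ (Fin k → Fin m) λ σ → Injective _≡_ _≡_ σ ×
    Σ (Fin (suc k)) λ i → Pattern F σ i v × ((u : Fin n) → Pattern F σ i u → u ≡ v)

HasHyperseparating : (n k m : ℕ) → Set
HasHyperseparating n k m = Σ (SetSystem n m) λ S → IsHyperseparating n m k (Data.Product.proj₁ S)

IsLeast : (ℕ → Set) → ℕ → Set
IsLeast P m = P m × ((m' : ℕ) → P m' → m ≤ m')

module Submission where

-- Lower bound: if the sets F(σ 1),…,F(σ k) of a system F isolate v, then v is determined by
-- its trace, the partial map on the m indices sending σ t to whether v ∈ F(σ t). Traces have
-- a k-element domain, and there are 2^k C(m,k) such partial maps.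
-- Upper bound: with up sets, give the n elements distinct k-subsets of the index set as codes,
-- listing first all k-subsets avoiding index 0 (fewer than n of them, by minimality of up), and
-- let set j consist of the elements whose code contains j. Every element is then the only one
-- in all sets of its code. By n > C(2k-1,k) we have up ≥ 2k, so the k-subsets avoiding 0
-- separate any two indices and the up sets are distinct.
-- Existence of f(n,k) follows since having a k-hyperseparating system of m sets is decidable.

open import Defs
open import Data.Nat using (ℕ; _≤_; _<_; _*_; _^_; _∸_)
open import Data.Nat.Combinatorics using (_C_)
open import Data.Product using (Σ; _×_)

open import Level using (0ℓ)
open import Function using (_∘_)
open import Function.Definitions using (Injective)
open import Data.Nat using (zero; suc; _+_; z≤n; s≤s; _≤′_; ≤′-refl; ≤′-step)
open import Data.Nat.Properties
  using (+-comm; +-suc; +-identityʳ; *-zeroʳ; suc-injective; ≤-refl; ≤-trans; ≤-reflexive; ≤-antisym;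
         m≤m+n; m≤n+m; <-irrefl; <-trans; <-≤-trans; <⇒≢; ≤⇒≯; ≰⇒>; ≮⇒≥; 1+n≰n; ≤⇒≤′; ∸-monoˡ-≤;
         _≤?_; _<?_; module ≤-Reasoning)
open import Data.Nat.Combinatorics using (k>n⇒nCk≡0; nCk+nC[k+1]≡[n+1]C[k+1])
open import Data.Nat.Tactic.RingSolver using (solve-∀)
open import Data.Bool using (Bool; true; false) renaming (_≟_ to _≟ᵇ_)
open import Data.Maybe using (Maybe; just; nothing; is-just)
open import Data.Fin using (Fin; zero; suc; toℕ; fromℕ; fromℕ<; inject≤; splitAt; join; _↑ˡ_; _↑ʳ_)
open import Data.Fin.Properties
  using (any?; all?; ¬∀⟶∃¬-smallest; injective⇒≤; toℕ-fromℕ; toℕ-fromℕ<; toℕ-inject; toℕ-inject≤;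
         toℕ-↑ˡ; toℕ<n; toℕ-injective; inject≤-injective; splitAt-↑ˡ; splitAt-↑ʳ; join-splitAt; 0≢1+n)
  renaming (_≟_ to _≟ᶠ_; suc-injective to Fin-suc-injective)
open import Data.Fin.Subset using (Subset; inside; outside; _∈_; _∉_; _⊆_; ∣_∣; ⁅_⁆; _∪_; ∁; ⊥; ⊤)
open import Data.Fin.Subset.Properties
  using (_∈?_; anySubset?; ⊆-antisym; ⊆-refl; s⊆s; out⊆; drop-∷-⊆; p⊂q⇒∣p∣<∣q∣; p⊆q⇒∣p∣≤∣q∣; ∉⊥;
         x∈⁅x⁆; x∈⁅y⁆⇒x≡y; x≢y⇒x∉⁅y⁆; x∉p⇒x∈∁p; x∈∁p⇒x∉p; x∈p∪q⁺; x∈p∪q⁻; ∪-identityˡ; ∣⊤∣≡n; ∣∁p∣≡n∸∣p∣;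
         ∣⁅x⁆∣≡1; ∣⊥∣≡0; ∈⊤)
open import Data.Vec using (Vec; []; _∷_; lookup; tabulate; map; here; there)
open import Data.Vec.Properties using (lookup∘tabulate; []=⇒lookup; lookup⇒[]=; ∷-injectiveʳ; ≡-dec)
open import Data.Vec.Functional using (Vector; head; tail) renaming (_∷_ to _∷ᶠ_)
open import Data.List as List using (List; length; _++_)
open import Data.List.Properties using (length-++; length-map)
open import Data.List.Membership.Propositional using () renaming (_∈_ to _∈ₗ_)
open import Data.List.Membership.Propositional.Properties using (∈-map⁺; ∈-++⁺ˡ; ∈-++⁺ʳ)
open import Data.List.Relation.Unary.Any as Any using (index)
open import Data.List.Relation.Unary.Any.Properties using (lookup-index)
open import Data.Product using (∃; _,_; proj₁; proj₂; map₂)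
open import Data.Sum using (inj₁; inj₂; [_,_]′)
open import Relation.Nullary using (Dec; yes; no; ¬_; contradiction)
open import Relation.Nullary.Decidable using (map′; _×-dec_; _→-dec_; ¬?; decidable-stable)
open import Relation.Unary using (Pred; Decidable)
open import Relation.Binary.Definitions using (DecidableEquality; _Respects_)
open import Relation.Binary.PropositionalEquality
  using (_≡_; _≢_; refl; sym; trans; cong; cong₂; subst; subst₂; _≗_; ≢-sym; module ≡-Reasoning)

private
  variable
    m n k : ℕ

-- Pascal's rule as a definition, so that splitAt divides Fin (binomial (suc m) (suc k))
-- into the indices of the k-subsets avoiding 0 and of those containing it.
binomial : ℕ → ℕ → ℕ
binomial zero    zero    = 1
binomial zero    (suc k) = 0
binomial (suc m) zero    = binomial m zero
binomial (suc m) (suc k) = binomial m (suc k) + binomial m k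

binomial-zeroʳ : ∀ m → binomial m zero ≡ 1
binomial-zeroʳ zero    = refl
binomial-zeroʳ (suc m) = binomial-zeroʳ m

binomial≡C : ∀ m k → binomial m k ≡ m C k
binomial≡C zero    zero    = refl
binomial≡C zero    (suc k) = sym (k>n⇒nCk≡0 {k = suc k} (s≤s z≤n))
binomial≡C (suc m) zero    = binomial-zeroʳ m
binomial≡C (suc m) (suc k) = begin
  binomial m (suc k) + binomial m k  ≡⟨ +-comm (binomial m (suc k)) _ ⟩
  binomial m k + binomial m (suc k)  ≡⟨ cong₂ _+_ (binomial≡C m k) (binomial≡C m (suc k)) ⟩
  m C k + m C suc k                  ≡⟨ nCk+nC[k+1]≡[n+1]C[k+1] m k ⟩
  suc m C suc k                      ∎
  where open ≡-Reasoning

binomial≤binomial-suc : ∀ m k → binomial m k ≤ binomial (suc m) k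
binomial≤binomial-suc m zero    = ≤-refl
binomial≤binomial-suc m (suc k) = m≤m+n (binomial m (suc k)) (binomial m k)

C-monoˡ-≤ : ∀ k → m ≤ n → m C k ≤ n C k
C-monoˡ-≤ {m} {n} k m≤n = subst₂ _≤_ (binomial≡C m k) (binomial≡C n k) (mono (≤⇒≤′ m≤n))
  where
  mono : ∀ {n} → m ≤′ n → binomial m k ≤ binomial n k
  mono         ≤′-refl         = ≤-refl
  mono {suc n} (≤′-step m≤′n) = ≤-trans (mono m≤′n) (binomial≤binomial-suc n k)

-- Deciding whether a hyperseparating system exists

Searchable : Set → Set₁
Searchable A = ∀ {P : Pred A 0ℓ} → Decidable P → Dec (∃ P)

anyVector? : ∀ {A} → Searchable A → ∀ m {P : Pred (Vector A m) 0ℓ} →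
             P Respects _≗_ → Decidable P → Dec (∃ P)
anyVector? search zero    P-resp P? =
  map′ (_ ,_) (λ (f , Pf) → P-resp (λ ()) Pf) (P? (λ ()))
anyVector? search (suc m) P-resp P? =
  map′ (λ (a , f , Paf) → a ∷ᶠ f , Paf)
       (λ (f , Pf) → head f , tail f , P-resp (λ { zero → refl ; (suc i) → refl }) Pf)
       (search λ a → anyVector? search m
         (λ f≗g → P-resp λ { zero → refl ; (suc i) → f≗g i }) (P? ∘ (a ∷ᶠ_)))

injective? : ∀ {a} {B : Set} → DecidableEquality B → (f : Fin a → B) → Dec (Injective _≡_ _≡_ f)
injective? _≟_ f = map′ (λ inj {x} {y} → inj x y) (λ inj x y → inj)
  (all? λ x → all? λ y → (f x ≟ f y) →-dec (x ≟ᶠ y))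

Injective-resp : ∀ {a} {B : Set} → (Injective {A = Fin a} {B = B} _≡_ _≡_) Respects _≗_
Injective-resp f≗g f-inj eq = f-inj (trans (f≗g _) (trans eq (sym (f≗g _))))

∃-least : ∀ {P : Pred ℕ 0ℓ} → Decidable P → ∀ {b} → P b → ∃ (IsLeast P)
∃-least {P} P? {b} Pb
  with ¬∀⟶∃¬-smallest (suc b) (¬_ ∘ P ∘ toℕ) (¬? ∘ P? ∘ toℕ)
         (λ ¬P → ¬P (fromℕ b) (subst P (sym (toℕ-fromℕ b)) Pb))
... | i , ¬¬Pi , ¬P-below = toℕ i , decidable-stable (P? (toℕ i)) ¬¬Pi , λ m Pm → ≮⇒≥ λ m<i →
  ¬P-below (fromℕ< m<i) (subst P (sym (trans (toℕ-inject (fromℕ< m<i)) (toℕ-fromℕ< m<i))) Pm)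

-- IsHyperseparating n m k F unfolds to ∀ v → Σ (Fin k → Fin m) (Isolates F v).
Isolates : (Fin m → Subset n) → Fin n → (Fin k → Fin m) → Set
Isolates {n = n} {k = k} F v σ =
  Injective _≡_ _≡_ σ × Σ (Fin (suc k)) λ i → Pattern F σ i v × ((u : Fin n) → Pattern F σ i u → u ≡ v)

Pattern-transfer : ∀ {F G : Fin m → Subset n} {σ τ : Fin k → Fin m} {i u w} →
                   (∀ j → lookup (F (σ j)) u ≡ lookup (G (τ j)) w) →
                   Pattern F σ i u → Pattern G τ i w
Pattern-transfer {u = u} {w} same pat j =
  (λ j<i → lookup⇒[]= w _ (trans (sym (same j)) ([]=⇒lookup (proj₁ (pat j) j<i)))) ,
  (λ i≤j w∈ → proj₂ (pat j) i≤j (lookup⇒[]= u _ (trans (same j) ([]=⇒lookup w∈))))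

Isolates-resp : ∀ {F G : Fin m → Subset n} {σ τ : Fin k → Fin m} {v} →
                F ≗ G → σ ≗ τ → Isolates F v σ → Isolates G v τ
Isolates-resp {F = F} {G} {σ} {τ} F≗G σ≗τ (σ-inj , i , pat , unique) =
  Injective-resp σ≗τ σ-inj , i , Pattern-transfer {F = F} {G = G} {σ} {τ} {i} same pat ,
  λ u → unique u ∘ Pattern-transfer {F = G} {G = F} {τ} {σ} {i} (λ j → sym (same j))
  where
  same : ∀ {u} j → lookup (F (σ j)) u ≡ lookup (G (τ j)) u
  same {u} j = cong (λ A → lookup A u) (trans (cong F (σ≗τ j)) (F≗G (τ j)))

Isolates⇒agree⇒≡ : ∀ {F : Fin m → Subset n} {σ : Fin k → Fin m} {v w} → Isolates F v σ →
                   (∀ j → lookup (F (σ j)) w ≡ lookup (F (σ j)) v) → w ≡ v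
Isolates⇒agree⇒≡ {F = F} {σ} {v} {w} (_ , i , pat , unique) agree =
  unique w (Pattern-transfer {F = F} {G = F} {σ} {σ} {i} {v} (λ j → sym (agree j)) pat)

pattern? : (F : Fin m → Subset n) (σ : Fin k → Fin m) → ∀ i u → Dec (Pattern F σ i u)
pattern? F σ i u = all? λ j →
  ((toℕ j <? toℕ i) →-dec (u ∈? F (σ j))) ×-dec ((toℕ i ≤? toℕ j) →-dec ¬? (u ∈? F (σ j)))

isolates? : (F : Fin m → Subset n) → ∀ v (σ : Fin k → Fin m) → Dec (Isolates F v σ)
isolates? F v σ = injective? _≟ᶠ_ σ ×-dec any? λ i →
  pattern? F σ i v ×-dec all? λ u → pattern? F σ i u →-dec (u ≟ᶠ v)

hasHyperseparating? : ∀ n k m → Dec (HasHyperseparating n k m)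
hasHyperseparating? n k m =
  map′ (λ (F , F-inj , sep) → (F , λ {x} {y} → F-inj {x} {y}) , sep)
       (λ ((F , F-inj) , sep) → F , (λ {x} {y} → F-inj {x} {y}) , sep)
    (anyVector? anySubset? m
      (λ F≗G (F-inj , sep) → Injective-resp F≗G F-inj ,
                             λ v → proj₁ (sep v) , Isolates-resp F≗G (λ _ → refl) (proj₂ (sep v)))
      λ F → injective? (≡-dec _≟ᵇ_) F ×-dec all? λ v →
              anyVector? any? k (Isolates-resp {F = F} (λ _ → refl)) (isolates? F v))

p⊆q∧∣p∣≡∣q∣⇒p≡q : ∀ {p q : Subset m} → p ⊆ q → ∣ p ∣ ≡ ∣ q ∣ → p ≡ q
p⊆q∧∣p∣≡∣q∣⇒p≡q {p = p} {q} p⊆q ∣p∣≡∣q∣ = ⊆-antisym p⊆q q⊆p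
  where
  q⊆p : q ⊆ p
  q⊆p {x} x∈q with x ∈? p
  ... | yes x∈p = x∈p
  ... | no  x∉p = contradiction ∣p∣≡∣q∣ (<⇒≢ (p⊂q⇒∣p∣<∣q∣ (p⊆q , x , x∈q , x∉p)))

x∉p⇒∣⁅x⁆∪p∣≡1+∣p∣ : ∀ (x : Fin m) p → x ∉ p → ∣ ⁅ x ⁆ ∪ p ∣ ≡ suc ∣ p ∣
x∉p⇒∣⁅x⁆∪p∣≡1+∣p∣ zero    (inside  ∷ p) x∉p = contradiction here x∉p
x∉p⇒∣⁅x⁆∪p∣≡1+∣p∣ zero    (outside ∷ p) _   = cong (suc ∘ ∣_∣) (∪-identityˡ p)
x∉p⇒∣⁅x⁆∪p∣≡1+∣p∣ (suc x) (inside  ∷ p) x∉p = cong suc (x∉p⇒∣⁅x⁆∪p∣≡1+∣p∣ x p (x∉p ∘ there))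
x∉p⇒∣⁅x⁆∪p∣≡1+∣p∣ (suc x) (outside ∷ p) x∉p = x∉p⇒∣⁅x⁆∪p∣≡1+∣p∣ x p (x∉p ∘ there)

⁅x⁆⊆∁⁅y⁆ : ∀ {x y : Fin m} → x ≢ y → ⁅ x ⁆ ⊆ ∁ ⁅ y ⁆
⁅x⁆⊆∁⁅y⁆ {x = x} x≢y z∈⁅x⁆ rewrite x∈⁅y⁆⇒x≡y x z∈⁅x⁆ = x∉p⇒x∈∁p (x≢y⇒x∉⁅y⁆ x≢y)

∃-⊆-⊆-∣∣≡ : ∀ (r q : Subset m) k → r ⊆ q → ∣ r ∣ ≤ k → k ≤ ∣ q ∣ →
            ∃ λ p → r ⊆ p × p ⊆ q × ∣ p ∣ ≡ k
∃-⊆-⊆-∣∣≡ []            []            zero    _   _ _ = [] , ⊆-refl , ⊆-refl , refl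
∃-⊆-⊆-∣∣≡ (inside  ∷ r) (outside ∷ q) k       r⊆q _ _ = contradiction (r⊆q here) λ ()
∃-⊆-⊆-∣∣≡ (inside  ∷ r) (inside  ∷ q) (suc k) r⊆q (s≤s r≤k) (s≤s k≤q) =
  let p , r⊆p , p⊆q , ∣p∣≡k = ∃-⊆-⊆-∣∣≡ r q k (drop-∷-⊆ r⊆q) r≤k k≤q
  in inside ∷ p , s⊆s r⊆p , s⊆s p⊆q , cong suc ∣p∣≡k
∃-⊆-⊆-∣∣≡ (outside ∷ r) (outside ∷ q) k       r⊆q r≤k k≤q =
  let p , r⊆p , p⊆q , ∣p∣≡k = ∃-⊆-⊆-∣∣≡ r q k (drop-∷-⊆ r⊆q) r≤k k≤q
  in outside ∷ p , s⊆s r⊆p , s⊆s p⊆q , ∣p∣≡k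
∃-⊆-⊆-∣∣≡ (outside ∷ r) (inside  ∷ q) k       r⊆q r≤k k≤1+q with k ≤? ∣ q ∣
... | yes k≤q =
  let p , r⊆p , p⊆q , ∣p∣≡k = ∃-⊆-⊆-∣∣≡ r q k (drop-∷-⊆ r⊆q) r≤k k≤q
  in outside ∷ p , s⊆s r⊆p , out⊆ p⊆q , ∣p∣≡k
... | no  k≰q = inside ∷ q , out⊆ (drop-∷-⊆ r⊆q) , ⊆-refl , sym (≤-antisym k≤1+q (≰⇒> k≰q))

image : (Fin k → Fin m) → Subset m
image {zero}  σ = ⊥
image {suc k} σ = ⁅ σ zero ⁆ ∪ image (σ ∘ suc)

∈-image⁺ : (σ : Fin k → Fin m) → ∀ t → σ t ∈ image σ
∈-image⁺ σ zero    = x∈p∪q⁺ (inj₁ (x∈⁅x⁆ (σ zero)))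
∈-image⁺ σ (suc t) = x∈p∪q⁺ (inj₂ (∈-image⁺ (σ ∘ suc) t))

∈-image⁻ : (σ : Fin k → Fin m) → ∀ {x} → x ∈ image σ → ∃ λ t → σ t ≡ x
∈-image⁻ {zero}  σ x∈ = contradiction x∈ ∉⊥
∈-image⁻ {suc k} σ x∈ with x∈p∪q⁻ ⁅ σ zero ⁆ (image (σ ∘ suc)) x∈
... | inj₁ x∈⁅σ0⁆ = zero , sym (x∈⁅y⁆⇒x≡y (σ zero) x∈⁅σ0⁆)
... | inj₂ x∈im   = let t , σ1+t≡x = ∈-image⁻ (σ ∘ suc) x∈im in suc t , σ1+t≡x

injective⇒∣image∣≡ : (σ : Fin k → Fin m) → Injective _≡_ _≡_ σ → ∣ image σ ∣ ≡ k
injective⇒∣image∣≡ {zero} {m} σ σ-inj = ∣⊥∣≡0 m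
injective⇒∣image∣≡ {suc k} σ σ-inj = begin
  ∣ ⁅ σ zero ⁆ ∪ image (σ ∘ suc) ∣  ≡⟨ x∉p⇒∣⁅x⁆∪p∣≡1+∣p∣ (σ zero) _ σ0∉ ⟩
  suc ∣ image (σ ∘ suc) ∣           ≡⟨ cong suc (injective⇒∣image∣≡ (σ ∘ suc) (Fin-suc-injective ∘ σ-inj)) ⟩
  suc k                             ∎
  where
  open ≡-Reasoning
  σ0∉ : σ zero ∉ image (σ ∘ suc)
  σ0∉ σ0∈ = let t , σ1+t≡σ0 = ∈-image⁻ (σ ∘ suc) σ0∈ in 0≢1+n (sym (σ-inj σ1+t≡σ0))

enumerate : (p : Subset m) → Fin ∣ p ∣ → Fin m
enumerate (inside  ∷ p) zero    = zero
enumerate (inside  ∷ p) (suc t) = suc (enumerate p t)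
enumerate (outside ∷ p) t       = suc (enumerate p t)

enumerate-∈ : ∀ (p : Subset m) t → enumerate p t ∈ p
enumerate-∈ (inside  ∷ p) zero    = here
enumerate-∈ (inside  ∷ p) (suc t) = there (enumerate-∈ p t)
enumerate-∈ (outside ∷ p) t       = there (enumerate-∈ p t)

enumerate-injective : ∀ (p : Subset m) → Injective _≡_ _≡_ (enumerate p)
enumerate-injective (inside  ∷ p) {zero}  {zero}  _  = refl
enumerate-injective (inside  ∷ p) {suc s} {suc t} eq = cong suc (enumerate-injective p (Fin-suc-injective eq))
enumerate-injective (outside ∷ p)                 eq = enumerate-injective p (Fin-suc-injective eq)

enumerate-surjective : ∀ (p : Subset m) {x} → x ∈ p → ∃ λ t → enumerate p t ≡ x
enumerate-surjective (inside  ∷ p) here       = zero , refl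
enumerate-surjective (inside  ∷ p) (there x∈) = let t , e = enumerate-surjective p x∈ in suc t , cong suc e
enumerate-surjective (outside ∷ p) (there x∈) = map₂ (cong suc) (enumerate-surjective p x∈)

enumeration : ∀ {p : Subset m} → ∣ p ∣ ≡ k →
              Σ (Fin k → Fin m) λ σ → Injective _≡_ _≡_ σ × (∀ t → σ t ∈ p) ×
                                      (∀ {x} → x ∈ p → ∃ λ t → σ t ≡ x)
enumeration {p = p} refl =
  enumerate p , enumerate-injective p , enumerate-∈ p , enumerate-surjective p

ksubset : ∀ m k → Fin (binomial m k) → Subset m
ksubset zero    zero    _ = []
ksubset (suc m) zero    x = outside ∷ ksubset m zero x
ksubset (suc m) (suc k) x =
  [ (outside ∷_) ∘ ksubset m (suc k) , (inside ∷_) ∘ ksubset m k ]′ (splitAt (binomial m (suc k)) x)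

ksubset-↑ˡ : ∀ m k x → ksubset (suc m) (suc k) (x ↑ˡ binomial m k) ≡ outside ∷ ksubset m (suc k) x
ksubset-↑ˡ m k x rewrite splitAt-↑ˡ (binomial m (suc k)) x (binomial m k) = refl

ksubset-↑ʳ : ∀ m k x → ksubset (suc m) (suc k) (binomial m (suc k) ↑ʳ x) ≡ inside ∷ ksubset m k x
ksubset-↑ʳ m k x rewrite splitAt-↑ʳ (binomial m (suc k)) (binomial m k) x = refl

∣ksubset∣ : ∀ m k x → ∣ ksubset m k x ∣ ≡ k
∣ksubset∣ zero    zero    _ = refl
∣ksubset∣ (suc m) zero    x = ∣ksubset∣ m zero x
∣ksubset∣ (suc m) (suc k) x with splitAt (binomial m (suc k)) x
... | inj₁ y = ∣ksubset∣ m (suc k) y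
... | inj₂ y = cong suc (∣ksubset∣ m k y)

ksubset-injective : ∀ m k → Injective _≡_ _≡_ (ksubset m k)
ksubset-injective zero    zero    {zero} {zero} _ = refl
ksubset-injective (suc m) zero    eq = ksubset-injective m zero (∷-injectiveʳ eq)
ksubset-injective (suc m) (suc k) {x} {y} eq = begin
  x                          ≡⟨ join-splitAt b₁ b₀ x ⟨
  join b₁ b₀ (splitAt b₁ x)  ≡⟨ cong (join b₁ b₀) (split-injective (splitAt b₁ x) (splitAt b₁ y) eq) ⟩
  join b₁ b₀ (splitAt b₁ y)  ≡⟨ join-splitAt b₁ b₀ y ⟩
  y                          ∎
  where
  open ≡-Reasoning
  b₁ = binomial m (suc k)
  b₀ = binomial m k
  pick = [ (outside ∷_) ∘ ksubset m (suc k) , (inside ∷_) ∘ ksubset m k ]′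
  split-injective : ∀ s t → pick s ≡ pick t → s ≡ t
  split-injective (inj₁ s) (inj₁ t) eq = cong inj₁ (ksubset-injective m (suc k) (∷-injectiveʳ eq))
  split-injective (inj₂ s) (inj₂ t) eq = cong inj₂ (ksubset-injective m k (∷-injectiveʳ eq))
  split-injective (inj₁ s) (inj₂ t) ()
  split-injective (inj₂ s) (inj₁ t) ()

ksubset-surjective : ∀ m k (p : Subset m) → ∣ p ∣ ≡ k → ∃ λ x → ksubset m k x ≡ p
ksubset-surjective zero    zero    []            _  = zero , refl
ksubset-surjective (suc m) zero    (outside ∷ p) eq = map₂ (cong (outside ∷_)) (ksubset-surjective m zero p eq)
ksubset-surjective (suc m) (suc k) (outside ∷ p) eq =
  let x , ksubset-x≡p = ksubset-surjective m (suc k) p eq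
  in x ↑ˡ binomial m k , trans (ksubset-↑ˡ m k x) (cong (outside ∷_) ksubset-x≡p)
ksubset-surjective (suc m) (suc k) (inside  ∷ p) eq =
  let x , ksubset-x≡p = ksubset-surjective m k p (suc-injective eq)
  in binomial m (suc k) ↑ʳ x , trans (ksubset-↑ʳ m k x) (cong (inside ∷_) ksubset-x≡p)

dual : (Fin n → Subset m) → Fin m → Subset n
dual F j = tabulate λ v → lookup (F v) j

lookup-dual : ∀ (F : Fin n → Subset m) v j → lookup (dual F j) v ≡ lookup (F v) j
lookup-dual F v j = lookup∘tabulate (λ u → lookup (F u) j) v

∈-dual⁺ : ∀ (F : Fin n → Subset m) {v j} → j ∈ F v → v ∈ dual F j
∈-dual⁺ F {v} {j} j∈ = lookup⇒[]= v _ (trans (lookup-dual F v j) ([]=⇒lookup j∈))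

∈-dual⁻ : ∀ (F : Fin n → Subset m) {v j} → v ∈ dual F j → j ∈ F v
∈-dual⁻ F {v} {j} v∈ = lookup⇒[]= j (F v) (trans (sym (lookup-dual F v j)) ([]=⇒lookup v∈))

-- The lower bound

dom : ∀ {A : Set} → Vec (Maybe A) m → Subset m
dom = map is-just

partialMaps : (m k : ℕ) → List (Vec (Maybe Bool) m)
partialMaps zero    zero    = List.[ [] ]
partialMaps zero    (suc k) = List.[]
partialMaps (suc m) zero    = List.map (nothing ∷_) (partialMaps m zero)
partialMaps (suc m) (suc k) =
  List.map (nothing ∷_) (partialMaps m (suc k)) ++
  List.map (just true ∷_) (partialMaps m k) ++ List.map (just false ∷_) (partialMaps m k)

partialMaps-complete : (m k : ℕ) (c : Vec (Maybe Bool) m) → ∣ dom c ∣ ≡ k → c ∈ₗ partialMaps m k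
partialMaps-complete zero    zero    []               _  = Any.here refl
partialMaps-complete (suc m) zero    (nothing ∷ c)    eq = ∈-map⁺ (nothing ∷_) (partialMaps-complete m zero c eq)
partialMaps-complete (suc m) (suc k) (nothing ∷ c)    eq =
  ∈-++⁺ˡ (∈-map⁺ (nothing ∷_) (partialMaps-complete m (suc k) c eq))
partialMaps-complete (suc m) (suc k) (just true ∷ c)  eq =
  ∈-++⁺ʳ (List.map (nothing ∷_) (partialMaps m (suc k)))
    (∈-++⁺ˡ (∈-map⁺ (just true ∷_) (partialMaps-complete m k c (suc-injective eq))))
partialMaps-complete (suc m) (suc k) (just false ∷ c) eq =
  ∈-++⁺ʳ (List.map (nothing ∷_) (partialMaps m (suc k)))
    (∈-++⁺ʳ (List.map (just true ∷_) (partialMaps m k))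
      (∈-map⁺ (just false ∷_) (partialMaps-complete m k c (suc-injective eq))))

length-partialMaps : (m k : ℕ) → length (partialMaps m k) ≡ 2 ^ k * binomial m k
length-partialMaps zero    zero    = refl
length-partialMaps zero    (suc k) = sym (*-zeroʳ (2 ^ suc k))
length-partialMaps (suc m) zero    =
  trans (length-map (nothing ∷_) (partialMaps m zero)) (length-partialMaps m zero)
length-partialMaps (suc m) (suc k) = begin
  length (nothing-first ++ true-first ++ false-first)
    ≡⟨ length-++ nothing-first {true-first ++ false-first} ⟩
  length nothing-first + length (true-first ++ false-first)
    ≡⟨ cong (length nothing-first +_) (length-++ true-first {false-first}) ⟩
  length nothing-first + (length true-first + length false-first)
    ≡⟨ cong₂ _+_ (length-map (nothing ∷_) (partialMaps m (suc k)))
                 (cong₂ _+_ (length-map (just true ∷_) (partialMaps m k))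
                            (length-map (just false ∷_) (partialMaps m k))) ⟩
  length (partialMaps m (suc k)) + (length (partialMaps m k) + length (partialMaps m k))
    ≡⟨ cong₂ (λ a b → a + (b + b)) (length-partialMaps m (suc k)) (length-partialMaps m k) ⟩
  2 ^ suc k * binomial m (suc k) + (2 ^ k * binomial m k + 2 ^ k * binomial m k)
    ≡⟨ distrib (2 ^ k) (binomial m k) (binomial m (suc k)) ⟩
  2 ^ suc k * (binomial m (suc k) + binomial m k)
    ∎
  where
  open ≡-Reasoning
  nothing-first = List.map (nothing ∷_) (partialMaps m (suc k))
  true-first      = List.map (just true ∷_) (partialMaps m k)
  false-first     = List.map (just false ∷_) (partialMaps m k)
  distrib : ∀ a b c → 2 * a * c + (a * b + a * b) ≡ 2 * a * (c + b)
  distrib = solve-∀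

restrict : Subset m → Subset m → Vec (Maybe Bool) m
restrict []            []      = []
restrict (inside  ∷ p) (b ∷ q) = just b ∷ restrict p q
restrict (outside ∷ p) (b ∷ q) = nothing ∷ restrict p q

dom-restrict : ∀ (p q : Subset m) → dom (restrict p q) ≡ p
dom-restrict []            []      = refl
dom-restrict (inside  ∷ p) (b ∷ q) = cong (inside ∷_) (dom-restrict p q)
dom-restrict (outside ∷ p) (b ∷ q) = cong (outside ∷_) (dom-restrict p q)

lookup-restrict : ∀ {p : Subset m} q {x} → x ∈ p → lookup (restrict p q) x ≡ just (lookup q x)
lookup-restrict {p = inside  ∷ p} (b ∷ q) here       = refl
lookup-restrict {p = inside  ∷ p} (b ∷ q) (there x∈) = lookup-restrict q x∈
lookup-restrict {p = outside ∷ p} (b ∷ q) (there x∈) = lookup-restrict q x∈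

lookup-restrict-just : ∀ (p q : Subset m) x {b} → lookup (restrict p q) x ≡ just b → lookup q x ≡ b
lookup-restrict-just (inside  ∷ p) (c ∷ q) zero    refl = refl
lookup-restrict-just (inside  ∷ p) (c ∷ q) (suc x) eq   = lookup-restrict-just p q x eq
lookup-restrict-just (outside ∷ p) (c ∷ q) (suc x) eq   = lookup-restrict-just p q x eq

injective⇒≤length : ∀ {A : Set} {xs : List A} (f : Fin n → A) → Injective _≡_ _≡_ f →
                    (∀ v → f v ∈ₗ xs) → n ≤ length xs
injective⇒≤length {xs = xs} f f-inj f∈xs = injective⇒≤ λ {v} {w} eq → f-inj (begin
  f v                               ≡⟨ lookup-index (f∈xs v) ⟩
  List.lookup xs (index (f∈xs v))   ≡⟨ cong (List.lookup xs) eq ⟩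
  List.lookup xs (index (f∈xs w))   ≡⟨ lookup-index (f∈xs w) ⟨
  f w                               ∎)
  where open ≡-Reasoning

lower-bound : HasHyperseparating n k m → n ≤ 2 ^ k * (m C k)
lower-bound {n} {k} {m} ((F , _) , sep) =
  subst (n ≤_) (trans (length-partialMaps m k) (cong (2 ^ k *_) (binomial≡C m k)))
    (injective⇒≤length trace trace-injective trace-∈)
  where
  σ : Fin n → Fin k → Fin m
  σ v = proj₁ (sep v)

  trace : Fin n → Vec (Maybe Bool) m
  trace v = restrict (image (σ v)) (dual F v)

  trace-∈ : ∀ v → trace v ∈ₗ partialMaps m k
  trace-∈ v = partialMaps-complete m k (trace v) (begin
    ∣ dom (trace v) ∣  ≡⟨ cong ∣_∣ (dom-restrict (image (σ v)) (dual F v)) ⟩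
    ∣ image (σ v) ∣    ≡⟨ injective⇒∣image∣≡ (σ v) (proj₁ (proj₂ (sep v))) ⟩
    k                  ∎)
    where open ≡-Reasoning

  trace-injective : Injective _≡_ _≡_ trace
  trace-injective {v} {w} eq = sym (Isolates⇒agree⇒≡ {F = F} (proj₂ (sep v)) agree)
    where
    agree : ∀ t → lookup (F (σ v t)) w ≡ lookup (F (σ v t)) v
    agree t = begin
      lookup (F j) w          ≡⟨ lookup-dual F j w ⟨
      lookup (dual F w) j     ≡⟨ lookup-restrict-just (image (σ w)) (dual F w) j (begin
        lookup (trace w) j          ≡⟨ cong (λ c → lookup c j) eq ⟨
        lookup (trace v) j          ≡⟨ lookup-restrict (dual F v) (∈-image⁺ (σ v) t) ⟩
        just (lookup (dual F v) j)  ∎) ⟩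
      lookup (dual F v) j     ≡⟨ lookup-dual F j v ⟩
      lookup (F j) v          ∎
      where
      open ≡-Reasoning
      j = σ v t

-- The upper bound

dual-isHyperseparating : (code : Fin n → Subset m) → Injective _≡_ _≡_ code → (∀ v → ∣ code v ∣ ≡ k) →
                         IsHyperseparating n m k (dual code)
dual-isHyperseparating {k = k} code code-inj ∣code∣≡k v with enumeration {p = code v} (∣code∣≡k v)
... | σ , σ-inj , σ-∈ , σ-onto = σ , σ-inj , fromℕ k , v-pattern , unique
  where
  t<k : ∀ t → toℕ t < toℕ (fromℕ k)
  t<k t = subst (toℕ t <_) (sym (toℕ-fromℕ k)) (toℕ<n t)

  v-pattern : Pattern (dual code) σ (fromℕ k) v
  v-pattern t = (λ _ → ∈-dual⁺ code (σ-∈ t)) , λ k≤t → contradiction (t<k t) (≤⇒≯ k≤t)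

  unique : ∀ u → Pattern (dual code) σ (fromℕ k) u → u ≡ v
  unique u pat = code-inj (sym (p⊆q∧∣p∣≡∣q∣⇒p≡q code-v⊆code-u (trans (∣code∣≡k v) (sym (∣code∣≡k u)))))
    where
    code-v⊆code-u : code v ⊆ code u
    code-v⊆code-u x∈ = let t , σt≡x = σ-onto x∈ in
      subst (_∈ code u) σt≡x (∈-dual⁻ code (proj₁ (pat t) (t<k t)))

dual-injective : (code : Fin n → Subset m) →
                 (∀ {a b} → a ≢ b → ∃ λ v → lookup (code v) a ≢ lookup (code v) b) →
                 Injective _≡_ _≡_ (dual code)
dual-injective code separates {a} {b} eq with a ≟ᶠ b
... | yes a≡b = a≡b
... | no  a≢b = let v , differ = separates a≢b in contradiction (begin
  lookup (code v) a       ≡⟨ lookup-dual code v a ⟨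
  lookup (dual code a) v  ≡⟨ cong (λ S → lookup S v) eq ⟩
  lookup (dual code b) v  ≡⟨ lookup-dual code v b ⟩
  lookup (code v) b       ∎) differ
  where open ≡-Reasoning

∈∧∉⇒lookup≢ : ∀ {p : Subset m} {x y} → x ∈ p → y ∉ p → lookup p x ≢ lookup p y
∈∧∉⇒lookup≢ {p = p} {y = y} x∈p y∉p eq = y∉p (lookup⇒[]= y p (trans (sym eq) ([]=⇒lookup x∈p)))

1+k≤∣∁⁅y⁆∣ : k + k < m → ∀ {x y : Fin m} → x ≢ y → suc k ≤ ∣ ∁ ⁅ y ⁆ ∣
1+k≤∣∁⁅y⁆∣ {zero}      _    {x}     x≢y =
  ≤-trans (≤-reflexive (sym (∣⁅x⁆∣≡1 x))) (p⊆q⇒∣p∣≤∣q∣ (⁅x⁆⊆∁⁅y⁆ x≢y))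
1+k≤∣∁⁅y⁆∣ {suc k} {m} 2k<m {y = y} _ = begin
  suc (suc k)    ≤⟨ ∸-monoˡ-≤ 1 (≤-trans (s≤s (s≤s (m≤n+m (suc k) k))) 2k<m) ⟩
  m ∸ 1          ≡⟨ cong (m ∸_) (∣⁅x⁆∣≡1 y) ⟨
  m ∸ ∣ ⁅ y ⁆ ∣  ≡⟨ ∣∁p∣≡n∸∣p∣ ⁅ y ⁆ ⟨
  ∣ ∁ ⁅ y ⁆ ∣    ∎
  where open ≤-Reasoning

-- As binomial m (suc k) < n, every (suc k)-subset of Fin (suc m) avoiding 0 is a code; these
-- separate any two points of Fin (suc m) once k + k < m, so the dual sets are distinct.
module KSubsetCode {k m n : ℕ} (2k<m : k + k < m) (C<n : binomial m (suc k) < n)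
                   (n≤ : n ≤ binomial (suc m) (suc k)) where

  code : Fin n → Subset (suc m)
  code v = ksubset (suc m) (suc k) (inject≤ v n≤)

  code-injective : Injective _≡_ _≡_ code
  code-injective eq = inject≤-injective n≤ n≤ _ _ (ksubset-injective (suc m) (suc k) eq)

  ∣code∣ : ∀ v → ∣ code v ∣ ≡ suc k
  ∣code∣ v = ∣ksubset∣ (suc m) (suc k) (inject≤ v n≤)

  avoiding-0⇒code : ∀ {p} → ∣ p ∣ ≡ suc k → ∃ λ v → code v ≡ outside ∷ p
  avoiding-0⇒code {p} ∣p∣ =
    fromℕ< x<n , trans (cong (ksubset (suc m) (suc k)) inject≡↑ˡ)
                       (trans (ksubset-↑ˡ m k x) (cong (outside ∷_) ksubset-x≡p))
    where
    x = proj₁ (ksubset-surjective m (suc k) p ∣p∣)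
    ksubset-x≡p = proj₂ (ksubset-surjective m (suc k) p ∣p∣)
    x<n : toℕ x < n
    x<n = <-trans (toℕ<n x) C<n
    inject≡↑ˡ : inject≤ (fromℕ< x<n) n≤ ≡ x ↑ˡ binomial m k
    inject≡↑ˡ = toℕ-injective (trans (toℕ-inject≤ _ n≤) (trans (toℕ-fromℕ< x<n) (sym (toℕ-↑ˡ x _))))

  avoiding-0-separates : ∀ {p x y} → ∣ p ∣ ≡ suc k → x ∈ outside ∷ p → y ∉ outside ∷ p →
                         ∃ λ v → lookup (code v) x ≢ lookup (code v) y
  avoiding-0-separates {x = x} {y} ∣p∣ x∈ y∉ =
    let v , code-v≡ = avoiding-0⇒code ∣p∣
    in v , subst (λ c → lookup c x ≢ lookup c y) (sym code-v≡) (∈∧∉⇒lookup≢ x∈ y∉)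

  ∣⁅a⁆∣≤1+k : ∀ (a : Fin m) → ∣ ⁅ a ⁆ ∣ ≤ suc k
  ∣⁅a⁆∣≤1+k a = ≤-trans (≤-reflexive (∣⁅x⁆∣≡1 a)) (s≤s z≤n)

  suc-separates : ∀ {a b} → suc a ≢ b → ∃ λ v → lookup (code v) (suc a) ≢ lookup (code v) b
  suc-separates {a} {zero} _ =
    let p , ⁅a⁆⊆p , _ , ∣p∣ = ∃-⊆-⊆-∣∣≡ ⁅ a ⁆ ⊤ (suc k) (λ _ → ∈⊤) (∣⁅a⁆∣≤1+k a) 1+k≤∣⊤∣
    in avoiding-0-separates ∣p∣ (there (⁅a⁆⊆p (x∈⁅x⁆ a))) λ ()
    where
    1+k≤∣⊤∣ = ≤-trans (≤-trans (s≤s (m≤m+n k k)) 2k<m) (≤-reflexive (sym (∣⊤∣≡n m)))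
  suc-separates {a} {suc b} 1+a≢1+b =
    let p , ⁅a⁆⊆p , p⊆∁⁅b⁆ , ∣p∣ = ∃-⊆-⊆-∣∣≡ ⁅ a ⁆ (∁ ⁅ b ⁆) (suc k) (⁅x⁆⊆∁⁅y⁆ a≢b) (∣⁅a⁆∣≤1+k a)
                                     (1+k≤∣∁⁅y⁆∣ 2k<m a≢b)
    in avoiding-0-separates ∣p∣ (there (⁅a⁆⊆p (x∈⁅x⁆ a)))
         λ { (there b∈p) → x∈∁p⇒x∉p (p⊆∁⁅b⁆ b∈p) (x∈⁅x⁆ b) }
    where
    a≢b = 1+a≢1+b ∘ cong suc

  code-separates : ∀ {a b} → a ≢ b → ∃ λ v → lookup (code v) a ≢ lookup (code v) b
  code-separates {zero}  {zero}  a≢b = contradiction refl a≢b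
  code-separates {zero}  {suc b} a≢b = map₂ ≢-sym (suc-separates (≢-sym a≢b))
  code-separates {suc a}         a≢b = suc-separates a≢b

  hasHyperseparating : HasHyperseparating n (suc k) (suc m)
  hasHyperseparating =
    (dual code , dual-injective code code-separates) , dual-isHyperseparating code code-injective ∣code∣

upper-bound : ∀ {k n up} → 1 ≤ k → 1 ≤ n → (2 * k ∸ 1) C k < n → IsLeast (λ m → n ≤ m C k) up →
              HasHyperseparating n k up
upper-bound {suc k} {n} {zero}  _ 1≤n _ (n≤0 , _) = contradiction (≤-trans 1≤n n≤0) λ ()
upper-bound {suc k} {n} {suc m} _ _ C<n (n≤up , up-least) =
  KSubsetCode.hasHyperseparating 2k<m
    (subst (_< n) (sym (binomial≡C m (suc k))) mC<n) (subst (n ≤_) (sym (binomial≡C (suc m) (suc k))) n≤up)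
  where
  mC<n : m C suc k < n
  mC<n = ≰⇒> λ n≤ → 1+n≰n (up-least m n≤)
  -- m ≥ 2 * suc k ∸ 1, which normalises to k + suc (k + 0), since otherwise suc m C suc k < n.
  2k<m : k + k < m
  2k<m = subst (_≤ m) (trans (+-suc k (k + 0)) (cong (λ i → suc (k + i)) (+-identityʳ k)))
    (≮⇒≥ λ m<2K-1 → <-irrefl refl (<-≤-trans C<n (≤-trans n≤up (C-monoˡ-≤ (suc k) m<2K-1))))

proposition2 : (k n : ℕ) → 1 ≤ k → 1 ≤ n → ((2 * k ∸ 1) C k) < n →
    (lo up : ℕ) → IsLeast (λ m → n ≤ (2 ^ k) * (m C k)) lo →
    IsLeast (λ m → n ≤ m C k) up →
    Σ ℕ λ f → IsLeast (HasHyperseparating n k) f × lo ≤ f × f ≤ up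
proposition2 k n 1≤k 1≤n C<n lo up (_ , lo-least) up-least =
  let f , has-f , f-least = ∃-least (hasHyperseparating? n k) has-up
  in f , (has-f , f-least) , lo-least f (lower-bound has-f) , f-least up has-up
  where
  has-up : HasHyperseparating n k up
  has-up = upper-bound 1≤k 1≤n C<n up-least
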